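{- Let $G=(V,E)$ be an average hereditary graph with $V\neq\emptyset$. If $\left\lceil \frac{|V|}{|V| - d(G)} \right\rceil = \lfloor d(G) + 1 \rfloor$, then $\chi(G) = \omega(G) = \lfloor d(G) + 1 \rfloor$.
   Context: All graphs are finite, simple and undirected. The average degree of $G$ is $d(G)=\frac{2|E|}{|V|}$ (for $V\ne\emptyset$). A graph $G$ is called average hereditary if for every induced subgraph $H$ of $G$ one has $d(H)\le d(G)$, where $d(H)=2|E(H)|/|V(H)|$ for nonempty $H$ and $d(H)=0$ for the null graph. $\chi(G)$ is the chromatic number and $\omega(G)$ the clique number (size of the largest complete subgraph) of $G$. -}

module Defs where

open import Data.Nat using (ℕ; zero; suc; _+_; _*_; _<?_)
open import Data.Bool using (Bool; true; false; _∧_; if_then_else_)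
open import Data.Fin using (Fin; toℕ)
open import Data.Fin.Subset using (Subset; ∣_∣)
open import Data.Fin.Subset.Properties using (_∈?_)
open import Data.Integer using (+_)
open import Data.Rational using (ℚ; 0ℚ; _/_)
open import Data.Product using (Σ; _×_)
open import Function.Definitions using (Injective)
open import Relation.Binary.PropositionalEquality using (_≡_; _≢_)
open import Relation.Nullary using (does)

record Graph : Set where
  field
    n      : ℕ
    adj    : Fin n → Fin n → Bool
    sym    : ∀ i j → adj i j ≡ adj j i
    irrefl : ∀ i → adj i i ≡ false
open Graph public

sumFin : ∀ {m} → (Fin m → ℕ) → ℕ
sumFin {zero}  f = 0
sumFin {suc m} f = f Fin.zero + sumFin (λ i → f (Fin.suc i))

edgesIn : (G : Graph) → Subset (n G) → ℕ
edgesIn G S = sumFin λ i → sumFin λ j →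
  if does (toℕ i <? toℕ j) ∧ does (i ∈? S) ∧ does (j ∈? S) ∧ adj G i j then 1 else 0

-- 2e / v, with the convention that the null graph (v = 0) has average degree 0
avg : ℕ → ℕ → ℚ
avg e zero    = 0ℚ
avg e (suc v) = + (2 * e) / suc v

avgDegSub : (G : Graph) → Subset (n G) → ℚ
avgDegSub G S = avg (edgesIn G S) ∣ S ∣

avgDeg : Graph → ℚ
avgDeg G = avg (edgesIn G Data.Fin.Subset.⊤) (n G)

AverageHereditary : Graph → Set
AverageHereditary G = ∀ (S : Subset (n G)) → avgDegSub G S Data.Rational.≤ avgDeg G

Colourable : Graph → ℕ → Set
Colourable G k = Σ (Fin (n G) → Fin k) λ c →
  ∀ i j → adj G i j ≡ true → c i ≢ c j

HasClique : Graph → ℕ → Set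
HasClique G k = Σ (Fin k → Fin (n G)) λ f →
  Injective _≡_ _≡_ f × (∀ a b → a ≢ b → adj G (f a) (f b) ≡ true)

IsChromaticNumber : Graph → ℕ → Set
IsChromaticNumber G k = Colourable G k × (∀ m → Colourable G m → k Data.Nat.≤ m)

IsCliqueNumber : Graph → ℕ → Set
IsCliqueNumber G k = HasClique G k × (∀ m → HasClique G m → m Data.Nat.≤ k)

ℕ→ℚ : ℕ → ℚ
ℕ→ℚ m = + m / 1

module Submission where

-- Let d = d(G) and k = ⌊d + 1⌋, so d < k. Every induced subgraph of the average hereditary graph G
-- has average degree at most d < k, hence a vertex of degree at most k − 1: G is (k − 1)-degenerate
-- and greedy colouring uses at most k colours. The hypothesis ⌈n / (n − d)⌉ = k means
-- k − 1 < n / (n − d), i.e. (k − 1) n² < n² + (k − 1) 2|E|, which contradicts Turán's bound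
-- r 2|E| + n² ≤ r n² for graphs without a clique on r + 1 vertices (r = k − 1). So ω ≥ k ≥ χ ≥ ω.

module RationalBounds where

  open import Defs using (avg; ℕ→ℚ)
  open import Data.Nat using (ℕ; zero; suc; _+_; _*_; _≤_; _<_; NonZero)
  import Data.Nat.Properties as ℕ
  open import Data.Integer as ℤ using (ℤ; +_; -[1+_]; +<+; +≤+)
  import Data.Integer.Properties as ℤ
  import Data.Integer.DivMod as ℤ
  open import Data.Integer.Tactic.RingSolver using (solve-∀)
  open import Data.Rational as ℚ using (ℚ; mkℚ; floor; ceiling; toℚᵘ; _÷_; 1ℚ)
  import Data.Rational.Properties as ℚ
  open import Data.Rational.Unnormalised as ℚᵘ using (ℚᵘ; mkℚᵘ; *≤*; *<*)
  import Data.Rational.Unnormalised.Properties as ℚᵘ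
  open import Data.Product using (∃; _×_; _,_)
  open import Relation.Binary.PropositionalEquality

  floor-upper : ∀ p → toℚᵘ p ℚᵘ.< mkℚᵘ (floor p ℤ.+ ℤ.1ℤ) 0
  floor-upper (mkℚ a b _) = *<* (begin-strict
      a ℤ.* + 1                          ≡⟨ ℤ.*-identityʳ a ⟩
      a                                  ≡⟨ ℤ.a≡a%n+[a/n]*n a d ⟩
      + (a ℤ.% d) ℤ.+ (a ℤ./ d) ℤ.* d   <⟨ ℤ.+-monoˡ-< ((a ℤ./ d) ℤ.* d) (+<+ (ℤ.n%d<d a d)) ⟩
      d ℤ.+ (a ℤ./ d) ℤ.* d             ≡⟨ d+z*d≡[z+1]*d (a ℤ./ d) d ⟩
      (a ℤ./ d ℤ.+ ℤ.1ℤ) ℤ.* d          ∎)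
    where
    d : ℤ
    d = + suc b
    open ℤ.≤-Reasoning
    d+z*d≡[z+1]*d : ∀ z d → d ℤ.+ z ℤ.* d ≡ (z ℤ.+ ℤ.1ℤ) ℤ.* d
    d+z*d≡[z+1]*d = solve-∀

  ceiling-lower : ∀ p → mkℚᵘ (ceiling p ℤ.- ℤ.1ℤ) 0 ℚᵘ.< toℚᵘ p
  ceiling-lower p@(mkℚ _ _ _) = ℚᵘ.<-respʳ-≃ -‿-p≃p
    (subst (λ z → mkℚᵘ z 0 ℚᵘ.< ℚᵘ.- toℚᵘ (ℚ.- p)) (ℤ.neg-distrib-+ (floor (ℚ.- p)) ℤ.1ℤ)
      (ℚᵘ.neg-mono-< (floor-upper (ℚ.- p))))
    where
    -‿-p≃p : ℚᵘ.- toℚᵘ (ℚ.- p) ℚᵘ.≃ toℚᵘ p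
    -‿-p≃p = ℚᵘ.≃-trans (ℚᵘ.-‿cong (ℚ.toℚᵘ-homo‿- p)) (ℚᵘ.neg-involutive (toℚᵘ p))

  toℚᵘ-avg : ∀ e m → toℚᵘ (avg e (suc m)) ℚᵘ.≃ mkℚᵘ (+ (2 * e)) m
  toℚᵘ-avg e m = ℚ.toℚᵘ-fromℚᵘ (mkℚᵘ (+ (2 * e)) m)

  avg-≤⇒ : ∀ a s b N → .{{NonZero s}} → .{{NonZero N}} → avg a s ℚ.≤ avg b N → 2 * a * N ≤ 2 * b * s
  avg-≤⇒ a (suc c) b (suc m) avg≤avg
    with ℚᵘ.≤-respʳ-≃ (toℚᵘ-avg b m) (ℚᵘ.≤-respˡ-≃ (toℚᵘ-avg a c) (ℚ.toℚᵘ-mono-≤ avg≤avg))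
  ... | *≤* cross =
    ℤ.drop‿+≤+ (subst₂ ℤ._≤_ (sym (ℤ.pos-* (2 * a) (suc m))) (sym (ℤ.pos-* (2 * b) (suc c))) cross)

  avg+1<⇒ : ∀ a m z → mkℚᵘ (+ a) m ℚᵘ.+ ℚᵘ.1ℚᵘ ℚᵘ.< mkℚᵘ (z ℤ.+ ℤ.1ℤ) 0 →
    + a ℤ.< z ℤ.* + suc m
  avg+1<⇒ a m z (*<* cross) = subst₂ ℤ._<_ (lhs≡ (+ a) N) (rhs≡ z N)
      (ℤ.+-monoˡ-< (ℤ.- N) (subst (λ k → lhs ℤ.< (z ℤ.+ ℤ.1ℤ) ℤ.* + k) (ℕ.*-identityʳ (suc m)) cross))
    where
    N lhs : ℤ
    N = + suc m
    lhs = (+ a ℤ.* + 1 ℤ.+ + 1 ℤ.* N) ℤ.* + 1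
    lhs≡ : ∀ a N → (a ℤ.* + 1 ℤ.+ + 1 ℤ.* N) ℤ.* + 1 ℤ.+ ℤ.- N ≡ a
    lhs≡ = solve-∀
    rhs≡ : ∀ z N → (z ℤ.+ ℤ.1ℤ) ℤ.* N ℤ.+ ℤ.- N ≡ z ℤ.* N
    rhs≡ = solve-∀

  floor-avg+1 : ∀ e N → .{{NonZero N}} → ∃ λ q → floor (avg e N ℚ.+ 1ℚ) ≡ + suc q × 2 * e < suc q * N
  floor-avg+1 e (suc m) = positive (floor p) refl (avg+1<⇒ (2 * e) m (floor p) avg+1<floor+1)
    where
    p : ℚ
    p = avg e (suc m) ℚ.+ 1ℚ
    avg+1<floor+1 : mkℚᵘ (+ (2 * e)) m ℚᵘ.+ ℚᵘ.1ℚᵘ ℚᵘ.< mkℚᵘ (floor p ℤ.+ ℤ.1ℤ) 0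
    avg+1<floor+1 = ℚᵘ.<-respˡ-≃
      (ℚᵘ.≃-trans (ℚ.toℚᵘ-homo-+ (avg e (suc m)) 1ℚ) (ℚᵘ.+-congˡ (toℚᵘ 1ℚ) (toℚᵘ-avg e m)))
      (floor-upper p)
    positive : ∀ z → floor p ≡ z → + (2 * e) ℤ.< z ℤ.* + suc m →
      ∃ λ q → floor p ≡ + suc q × 2 * e < suc q * suc m
    positive (+ zero)    _  (+<+ ())
    positive (+ suc q)   eq 2e<z*N = q , eq , ℤ.drop‿+<+ 2e<z*N
    positive -[1+ _ ]    _  ()

  cross-ratio : ∀ q a m →
    mkℚᵘ (+ q) 0 ℚᵘ.* (mkℚᵘ (+ suc m) 0 ℚᵘ.- mkℚᵘ (+ a) m) ℚᵘ.< mkℚᵘ (+ suc m) 0 →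
    q * (suc m * suc m) < suc m * suc m + q * a
  cross-ratio q a m (*<* cross) = ℤ.drop‿+<+ (subst₂ ℤ._<_ lhs≡ rhs≡ (ℤ.+-monoˡ-< (+ q ℤ.* + a) cross))
    where
    N : ℕ
    N = suc m
    lhs≡ : (+ q ℤ.* (+ N ℤ.* + N ℤ.+ ℤ.- (+ a) ℤ.* + 1)) ℤ.* + 1 ℤ.+ + q ℤ.* + a ≡ + (q * (N * N))
    lhs≡ = begin
      (+ q ℤ.* (+ N ℤ.* + N ℤ.+ ℤ.- (+ a) ℤ.* + 1)) ℤ.* + 1 ℤ.+ + q ℤ.* + a
        ≡⟨ cancel (+ q) (+ N) (+ a) ⟩
      + q ℤ.* (+ N ℤ.* + N)                                                ≡⟨ cong (+ q ℤ.*_) (ℤ.pos-* N N) ⟨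
      + q ℤ.* + (N * N)                                                    ≡⟨ ℤ.pos-* q (N * N) ⟨
      + (q * (N * N))                                                      ∎
      where
      open ≡-Reasoning
      cancel : ∀ q n a → (q ℤ.* (n ℤ.* n ℤ.+ ℤ.- a ℤ.* + 1)) ℤ.* + 1 ℤ.+ q ℤ.* a ≡ q ℤ.* (n ℤ.* n)
      cancel = solve-∀
    rhs≡ : + N ℤ.* + (1 * (1 * N)) ℤ.+ + q ℤ.* + a ≡ + (N * N + q * a)
    rhs≡ = begin
      + N ℤ.* + (1 * (1 * N)) ℤ.+ + q ℤ.* + a
        ≡⟨ cong (λ k → + N ℤ.* + k ℤ.+ + q ℤ.* + a) (ℕ.*-identityˡ (1 * N)) ⟩
      + N ℤ.* + (1 * N) ℤ.+ + q ℤ.* + a        ≡⟨ cong₂ ℤ._+_ (ℤ.pos-* N (1 * N)) (ℤ.pos-* q a) ⟨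
      + (N * (1 * N)) ℤ.+ + (q * a)            ≡⟨ ℤ.pos-+ (N * (1 * N)) (q * a) ⟨
      + (N * (1 * N) + q * a)                  ≡⟨ cong (λ k → + (N * k + q * a)) (ℕ.*-identityˡ N) ⟩
      + (N * N + q * a)                        ∎
      where open ≡-Reasoning

  ceiling-ratio : ∀ e N q → .{{NonZero N}} → 2 * e ≤ N * N → {{_ : ℚ.NonZero (ℕ→ℚ N ℚ.- avg e N)}} →
    ceiling (ℕ→ℚ N ÷ (ℕ→ℚ N ℚ.- avg e N)) ≡ + suc q → q * (N * N) < N * N + q * (2 * e)
  ceiling-ratio e N@(suc m) q 2e≤N² ceiling≡ = cross-ratio q (2 * e) m (ℚᵘ.<-respʳ-≃ toℚᵘ-N qy<N)
    where
    y x : ℚ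
    y = ℕ→ℚ N ℚ.- avg e N
    x = ℕ→ℚ N ÷ y
    yᵘ : ℚᵘ
    yᵘ = mkℚᵘ (+ N) 0 ℚᵘ.- mkℚᵘ (+ (2 * e)) m
    toℚᵘ-N : toℚᵘ (ℕ→ℚ N) ℚᵘ.≃ mkℚᵘ (+ N) 0
    toℚᵘ-N = ℚ.toℚᵘ-fromℚᵘ (mkℚᵘ (+ N) 0)
    toℚᵘ-y : toℚᵘ y ℚᵘ.≃ yᵘ
    toℚᵘ-y = ℚᵘ.≃-trans (ℚ.toℚᵘ-homo-+ (ℕ→ℚ N) (ℚ.- avg e N))
      (ℚᵘ.+-cong toℚᵘ-N (ℚᵘ.≃-trans (ℚ.toℚᵘ-homo‿- (avg e N)) (ℚᵘ.-‿cong (toℚᵘ-avg e m))))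
    0≤y : ℚ.0ℚ ℚ.≤ y
    0≤y = ℚ.toℚᵘ-cancel-≤ (ℚᵘ.≤-respʳ-≃ (ℚᵘ.≃-sym toℚᵘ-y)
      (ℚᵘ.p≤q⇒0≤q-p {mkℚᵘ (+ (2 * e)) m} {mkℚᵘ (+ N) 0} (*≤* 2e*1≤N*N)))
      where
      2e*1≤N*N : + (2 * e) ℤ.* + 1 ℤ.≤ + N ℤ.* + N
      2e*1≤N*N = subst₂ ℤ._≤_ (trans (cong +_ (sym (ℕ.*-identityʳ (2 * e)))) (ℤ.pos-* (2 * e) 1))
        (ℤ.pos-* N N) (+≤+ 2e≤N²)
    instance
      y-positive : ℚ.Positive y
      y-positive = ℚ.nonNeg∧nonZero⇒pos y {{ℚ.nonNegative 0≤y}}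
    x*y≡N : x ℚ.* y ≡ ℕ→ℚ N
    x*y≡N = begin
      ℕ→ℚ N ℚ.* ℚ.1/ y ℚ.* y      ≡⟨ ℚ.*-assoc (ℕ→ℚ N) (ℚ.1/ y) y ⟩
      ℕ→ℚ N ℚ.* (ℚ.1/ y ℚ.* y)    ≡⟨ cong (ℕ→ℚ N ℚ.*_) (ℚ.*-inverseˡ y) ⟩
      ℕ→ℚ N ℚ.* 1ℚ                ≡⟨ ℚ.*-identityʳ (ℕ→ℚ N) ⟩
      ℕ→ℚ N                        ∎
      where open ≡-Reasoning
    q<x : ℕ→ℚ q ℚ.< x
    q<x = ℚ.toℚᵘ-cancel-< (ℚᵘ.<-respˡ-≃ (ℚᵘ.≃-sym (ℚ.toℚᵘ-fromℚᵘ (mkℚᵘ (+ q) 0)))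
      (subst (λ k → mkℚᵘ (k ℤ.- ℤ.1ℤ) 0 ℚᵘ.< toℚᵘ x) ceiling≡ (ceiling-lower x)))
    qy<N : mkℚᵘ (+ q) 0 ℚᵘ.* yᵘ ℚᵘ.< toℚᵘ (ℕ→ℚ N)
    qy<N = ℚᵘ.<-respˡ-≃
      (ℚᵘ.≃-trans (ℚ.toℚᵘ-homo-* (ℕ→ℚ q) y) (ℚᵘ.*-cong (ℚ.toℚᵘ-fromℚᵘ (mkℚᵘ (+ q) 0)) toℚᵘ-y))
      (ℚ.toℚᵘ-mono-< (subst (ℕ→ℚ q ℚ.* y ℚ.<_) x*y≡N (ℚ.*-monoˡ-<-pos y q<x)))

module Combinatorics where

  open import Defs renaming (sym to adj-sym)
  open RationalBounds using (avg-≤⇒)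
  open import Data.Nat hiding (_≟_)
  open import Data.Nat.Properties hiding (_≟_)
  open import Data.Nat.Tactic.RingSolver using (solve-∀)
  open import Algebra.Properties.Semiring.Sum +-*-semiring
    using (sum; sum-syntax; ∑-distrib-+; ∑-comm; sum-cong-≗; sum-replicate-zero; *-distribʳ-sum)
  open import Data.Bool using (Bool; true; false; _∧_; not; if_then_else_)
  import Data.Bool.Properties as Bool
  open import Data.Fin using (Fin; zero; suc; toℕ)
  open import Data.Fin.Properties using (_≟_; any?; injective⇒≤; toℕ-injective)
  open import Data.Fin.Subset using (Subset; ∣_∣; ⊤)
  open import Data.Fin.Subset.Properties using (_∈?_)
  open import Data.Vec using ([]; _∷_; lookup; tabulate)
  open import Data.Vec.Properties using (lookup∘tabulate; lookup-replicate)
  import Data.Vec.Functional as Vector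
  open import Data.List using (allFin)
  open import Data.List.Extrema.Nat using (argmax; f[xs]≤f[argmax])
  open import Data.List.Membership.Propositional.Properties using (∈-allFin)
  import Data.List.Relation.Unary.All as All
  open import Data.Product using (Σ; ∃; _×_; _,_; proj₁; proj₂)
  open import Data.Sum using (_⊎_; inj₁; inj₂)
  open import Function using (_∘_)
  open import Relation.Binary.PropositionalEquality
    using (_≡_; _≢_; refl; sym; trans; cong; cong₂; subst; subst₂; module ≡-Reasoning)
  open import Relation.Nullary using (does; yes; no; contradiction)
  open import Relation.Nullary.Decidable using (dec-true; dec-false; _×-dec_)
  open import Relation.Binary.Definitions using (tri<; tri≈; tri>)
  open import Algebra.Bundles using (CommutativeMonoid)
  open import Algebra.Properties.CommutativeSemigroup
    (CommutativeMonoid.commutativeSemigroup Bool.∧-commutativeMonoid) using (x∙yz≈y∙xz)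

  sumFin≡sum : ∀ {m} (f : Fin m → ℕ) → sumFin f ≡ sum f
  sumFin≡sum {zero}  f = refl
  sumFin≡sum {suc m} f = cong (f zero +_) (sumFin≡sum (f ∘ suc))

  sumFin²≡sum² : ∀ {m k} (f : Fin m → Fin k → ℕ) →
    sumFin (λ i → sumFin (f i)) ≡ ∑[ i < m ] ∑[ j < k ] f i j
  sumFin²≡sum² f = trans (sumFin≡sum (λ i → sumFin (f i))) (sum-cong-≗ λ i → sumFin≡sum (f i))

  sum-mono-≤ : ∀ {m} {f g : Fin m → ℕ} → (∀ i → f i ≤ g i) → sum f ≤ sum g
  sum-mono-≤ {zero}  f≤g = z≤n
  sum-mono-≤ {suc m} f≤g = +-mono-≤ (f≤g zero) (sum-mono-≤ (f≤g ∘ suc))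

  ≤-sum : ∀ {m} (f : Fin m → ℕ) i → f i ≤ sum f
  ≤-sum f zero    = m≤m+n (f zero) _
  ≤-sum f (suc i) = ≤-trans (≤-sum (f ∘ suc) i) (m≤n+m _ (f zero))

  sum-<⇒∃< : ∀ {m} (f g : Fin m → ℕ) → sum f < sum g → ∃ λ i → f i < g i
  sum-<⇒∃< {zero}  f g ()
  sum-<⇒∃< {suc m} f g Σf<Σg with f zero <? g zero
  ... | yes f₀<g₀ = zero , f₀<g₀
  ... | no  f₀≮g₀ with sum-<⇒∃< (f ∘ suc) (g ∘ suc)
                        (+-cancelˡ-< (f zero) _ _ (<-≤-trans Σf<Σg (+-monoˡ-≤ _ (≮⇒≥ f₀≮g₀))))
  ...   | i , fᵢ<gᵢ = suc i , fᵢ<gᵢ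

  ∑1≡n : ∀ n → ∑[ i < n ] 1 ≡ n
  ∑1≡n zero    = refl
  ∑1≡n (suc n) = cong suc (∑1≡n n)

  ∑0≡0 : ∀ n → ∑[ i < n ] 0 ≡ 0
  ∑0≡0 = sum-replicate-zero

  argmaxOn : ∀ {m} (S : Fin m → Bool) (f : Fin m → ℕ) → ∃ (λ i → S i ≡ true) →
    ∃ λ v → S v ≡ true × (∀ i → S i ≡ true → f i ≤ f v)
  argmaxOn {m} S f (i₀ , S∋i₀) = v , S∋v , f≤f[v]
    where
    weight : Fin m → ℕ
    weight i = if S i then suc (f i) else 0
    v : Fin m
    v = argmax weight i₀ (allFin m)
    weight≤ : ∀ i → weight i ≤ weight v
    weight≤ i = All.lookup (f[xs]≤f[argmax] i₀ (allFin m)) (∈-allFin i)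
    S∋v : S v ≡ true
    S∋v with S v | weight≤ i₀
    ... | true  | _ = refl
    ... | false | w≤0 rewrite S∋i₀ = contradiction w≤0 λ ()
    f≤f[v] : ∀ i → S i ≡ true → f i ≤ f v
    f≤f[v] i S∋i with weight≤ i
    ... | w≤ rewrite S∋i | S∋v = s≤s⁻¹ w≤

  -- Sets of vertices as Boolean predicates

  _∩_ _∖_ : ∀ {m} → (Fin m → Bool) → (Fin m → Bool) → Fin m → Bool
  (X ∩ W) i = X i ∧ W i
  (X ∖ W) i = X i ∧ not (W i)

  _⊆_ : ∀ {m} → (Fin m → Bool) → (Fin m → Bool) → Set
  X ⊆ Y = ∀ i → X i ≡ true → Y i ≡ true

  ∩-⊆ˡ : ∀ {m} (X W : Fin m → Bool) → (X ∩ W) ⊆ X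
  ∩-⊆ˡ X W i = Bool.∧-conicalˡ (X i) (W i)

  ∩-⊆ʳ : ∀ {m} (X W : Fin m → Bool) → (X ∩ W) ⊆ W
  ∩-⊆ʳ X W i = Bool.∧-conicalʳ (X i) (W i)

  ∖-⊆ : ∀ {m} (X W : Fin m → Bool) → (X ∖ W) ⊆ X
  ∖-⊆ X W i = Bool.∧-conicalˡ (X i) (not (W i))

  ⁅_⁆ : ∀ {m} → Fin m → Fin m → Bool
  ⁅ v ⁆ i = does (i ≟ v)

  [_] : Bool → ℕ
  [ b ] = if b then 1 else 0

  []≤1 : ∀ b → [ b ] ≤ 1
  []≤1 false = z≤n
  []≤1 true  = ≤-refl

  []-split : ∀ a w → [ a ] ≡ [ a ∧ w ] + [ a ∧ not w ]
  []-split false w     = refl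
  []-split true  true  = refl
  []-split true  false = refl

  [∧]-split : ∀ a w r → [ a ∧ r ] ≡ [ (a ∧ w) ∧ r ] + [ (a ∧ not w) ∧ r ]
  [∧]-split false w     r = refl
  [∧]-split true  true  r = sym (+-identityʳ [ r ])
  [∧]-split true  false r = refl

  ∑[≟]≡1 : ∀ {m} (v : Fin m) → ∑[ i < m ] [ does (i ≟ v) ] ≡ 1
  ∑[≟]≡1 {suc m} zero    = cong suc (∑0≡0 m)
  ∑[≟]≡1 {suc m} (suc v) = ∑[≟]≡1 v

  ∣∣≡∑ : ∀ {m} (T : Subset m) → ∣ T ∣ ≡ ∑[ i < m ] [ lookup T i ]
  ∣∣≡∑ []          = refl
  ∣∣≡∑ (true ∷ T)  = cong suc (∣∣≡∑ T)
  ∣∣≡∑ (false ∷ T) = ∣∣≡∑ T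

  does-∈? : ∀ {m} (i : Fin m) (T : Subset m) → does (i ∈? T) ≡ lookup T i
  does-∈? zero    (true ∷ T)  = refl
  does-∈? zero    (false ∷ T) = refl
  does-∈? (suc i) (_ ∷ T)     = does-∈? i T

  2xy≤x²+y² : ∀ x y → 2 * (x * y) ≤ x * x + y * y
  2xy≤x²+y² x y with ≤-total x y
  ... | inj₁ x≤y with m≤n⇒∃[o]m+o≡n x≤y
  ...   | d , refl = ≤-trans (m≤m+n _ (d * d)) (≤-reflexive (square x d))
    where
    square : ∀ x d → 2 * (x * (x + d)) + d * d ≡ x * x + (x + d) * (x + d)
    square = solve-∀
  2xy≤x²+y² x y | inj₂ y≤x with m≤n⇒∃[o]m+o≡n y≤x
  ...   | d , refl = ≤-trans (m≤m+n _ (d * d)) (≤-reflexive (square y d))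
    where
    square : ∀ y d → 2 * ((y + d) * y) + d * d ≡ (y + d) * (y + d) + y * y
    square = solve-∀

  -- The inductive step of Turán's theorem: Δ = |A| and b = |B| for the split of S into the neighbours
  -- A and non-neighbours B of a vertex of maximum degree Δ, with DS and DA the degree sums of G[S], G[A].
  turán-step : ∀ p DA DS Δ b →
    p * DA + Δ * Δ ≤ p * (Δ * Δ) → DS ≤ DA + b * Δ + b * Δ → DS ≤ (Δ + b) * Δ →
    suc p * DS + (Δ + b) * (Δ + b) ≤ suc p * ((Δ + b) * (Δ + b))
  turán-step zero DA DS zero b _ _ DS≤ rewrite n≤0⇒n≡0 (≤-trans DS≤ (≤-reflexive (*-zeroʳ b))) =
    ≤-reflexive (sym (*-identityˡ _))
  turán-step zero DA DS (suc Δ) b () _ _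
  turán-step (suc p) DA DS Δ b IH DS≤ _ = *-cancelˡ-≤ P (+-cancelʳ-≤ K _ _ (begin
      P * (r * DS + s * s) + K                        ≡⟨ expand P r DS s K ⟩
      P * r * DS + P * (s * s) + K
        ≤⟨ +-monoˡ-≤ K (+-monoˡ-≤ (P * (s * s)) (*-monoʳ-≤ (P * r) DS≤)) ⟩
      P * r * (DA + bΔ + bΔ) + P * (s * s) + K        ≡⟨ regroup P DA b Δ ⟩
      r * (P * DA + Δ * Δ) + P * r * (bΔ + bΔ) + P * (s * s)
        ≤⟨ +-monoˡ-≤ (P * (s * s)) (+-monoˡ-≤ (P * r * (bΔ + bΔ)) (*-monoʳ-≤ r IH)) ⟩
      r * (P * (Δ * Δ)) + P * r * (bΔ + bΔ) + P * (s * s)  ≤⟨ square-gap ⟩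
      P * (r * (s * s)) + K                           ∎))
    where
    open ≤-Reasoning
    P r s bΔ K : ℕ
    P = suc p
    r = suc P
    s = Δ + b
    bΔ = b * Δ
    K = r * (Δ * Δ)
    expand : ∀ P r DS s K → P * (r * DS + s * s) + K ≡ P * r * DS + P * (s * s) + K
    expand = solve-∀
    regroup : ∀ P DA b Δ → P * suc P * (DA + b * Δ + b * Δ) + P * ((Δ + b) * (Δ + b)) + suc P * (Δ * Δ)
      ≡ suc P * (P * DA + Δ * Δ) + P * suc P * (b * Δ + b * Δ) + P * ((Δ + b) * (Δ + b))
    regroup = solve-∀
    -- the difference of the two sides is (Δ − P b)²
    square-gap : r * (P * (Δ * Δ)) + P * r * (bΔ + bΔ) + P * (s * s) ≤ P * (r * (s * s)) + K
    square-gap = +-cancelʳ-≤ (2 * ((P * b) * Δ)) lhs _ (≤-trans (+-monoʳ-≤ lhs (2xy≤x²+y² (P * b) Δ))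
      (≤-reflexive (expand-square P b Δ)))
      where
      lhs : ℕ
      lhs = r * (P * (Δ * Δ)) + P * r * (bΔ + bΔ) + P * (s * s)
      expand-square : ∀ P b Δ → suc P * (P * (Δ * Δ)) + P * suc P * (b * Δ + b * Δ) + P * ((Δ + b) * (Δ + b))
        + ((P * b) * (P * b) + Δ * Δ) ≡ P * (suc P * ((Δ + b) * (Δ + b))) + suc P * (Δ * Δ) + 2 * ((P * b) * Δ)
      expand-square = solve-∀

  module _ (G : Graph) where

    V : Fin (n G) → Bool
    V _ = true

    size : (Fin (n G) → Bool) → ℕ
    size S = ∑[ i < n G ] [ S i ]

    degreeIn : (Fin (n G) → Bool) → Fin (n G) → ℕ
    degreeIn Y i = ∑[ j < n G ] [ Y j ∧ adj G i j ]

    -- adjacentPairs S S is the degree sum 2|E(G[S])| of G[S]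
    adjacentPairs : (X Y : Fin (n G) → Bool) → ℕ
    adjacentPairs X Y = ∑[ i < n G ] ∑[ j < n G ] [ X i ∧ Y j ∧ adj G i j ]

    size-split : ∀ X W → size X ≡ size (X ∩ W) + size (X ∖ W)
    size-split X W = trans (sum-cong-≗ λ i → []-split (X i) (W i))
      (∑-distrib-+ (λ i → [ (X ∩ W) i ]) (λ i → [ (X ∖ W) i ]))

    size-singleton : ∀ S v → S v ≡ true → size (S ∩ ⁅ v ⁆) ≡ 1
    size-singleton S v S∋v = trans (sum-cong-≗ term) (∑[≟]≡1 v)
      where
      term : ∀ i → [ S i ∧ does (i ≟ v) ] ≡ [ does (i ≟ v) ]
      term i with i ≟ v
      ... | yes refl rewrite S∋v = refl
      ... | no  _    rewrite Bool.∧-zeroʳ (S i) = refl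

    nonempty : ∀ S → 0 < size S → ∃ λ i → S i ≡ true
    nonempty S 0<|S| with sum-<⇒∃< (λ _ → 0) (λ i → [ S i ]) (subst (_< size S) (sym (∑0≡0 (n G))) 0<|S|)
    ... | i , 0<[Sᵢ] with S i in eq
    ...   | true = i , eq

    ∈⇒0<size : ∀ S i → S i ≡ true → 0 < size S
    ∈⇒0<size S i S∋i = <-≤-trans (subst (λ b → 0 < [ b ]) (sym S∋i) z<s) (≤-sum (λ j → [ S j ]) i)

    degreeIn≤n : ∀ Y i → degreeIn Y i ≤ n G
    degreeIn≤n Y i = ≤-trans (sum-mono-≤ λ j → []≤1 (Y j ∧ adj G i j)) (≤-reflexive (∑1≡n (n G)))

    degreeIn-mono : ∀ {Y Y′} → Y ⊆ Y′ → ∀ i → degreeIn Y i ≤ degreeIn Y′ i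
    degreeIn-mono {Y} {Y′} Y⊆Y′ i = sum-mono-≤ term
      where
      term : ∀ j → [ Y j ∧ adj G i j ] ≤ [ Y′ j ∧ adj G i j ]
      term j with Y j in eq
      ... | true  rewrite Y⊆Y′ j eq = ≤-refl
      ... | false = z≤n

    adjacentPairs-byRows : ∀ X Y → adjacentPairs X Y ≡ ∑[ i < n G ] (if X i then degreeIn Y i else 0)
    adjacentPairs-byRows X Y = sum-cong-≗ row
      where
      row : ∀ i → ∑[ j < n G ] [ X i ∧ Y j ∧ adj G i j ] ≡ (if X i then degreeIn Y i else 0)
      row i with X i
      ... | true  = refl
      ... | false = ∑0≡0 (n G)

    adjacentPairs-≤ : ∀ X Y Δ → (∀ i → X i ≡ true → degreeIn Y i ≤ Δ) →
      adjacentPairs X Y ≤ size X * Δ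
    adjacentPairs-≤ X Y Δ Δ-bound = begin
      adjacentPairs X Y                                ≡⟨ adjacentPairs-byRows X Y ⟩
      ∑[ i < n G ] (if X i then degreeIn Y i else 0)  ≤⟨ sum-mono-≤ row ⟩
      ∑[ i < n G ] ([ X i ] * Δ)                      ≡⟨ *-distribʳ-sum Δ (λ i → [ X i ]) ⟨
      size X * Δ                                       ∎
      where
      open ≤-Reasoning
      row : ∀ i → (if X i then degreeIn Y i else 0) ≤ [ X i ] * Δ
      row i with X i in eq
      ... | true  = subst (_ ≤_) (sym (*-identityˡ Δ)) (Δ-bound i eq)
      ... | false = z≤n

    size*δ≤adjacentPairs : ∀ X Y δ → (∀ i → X i ≡ true → δ ≤ degreeIn Y i) →
      size X * δ ≤ adjacentPairs X Y
    size*δ≤adjacentPairs X Y δ δ-bound = begin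
      size X * δ                                       ≡⟨ *-distribʳ-sum δ (λ i → [ X i ]) ⟩
      ∑[ i < n G ] ([ X i ] * δ)                      ≤⟨ sum-mono-≤ row ⟩
      ∑[ i < n G ] (if X i then degreeIn Y i else 0)  ≡⟨ adjacentPairs-byRows X Y ⟨
      adjacentPairs X Y                                ∎
      where
      open ≤-Reasoning
      row : ∀ i → [ X i ] * δ ≤ (if X i then degreeIn Y i else 0)
      row i with X i in eq
      ... | true  = subst (_≤ _) (sym (*-identityˡ δ)) (δ-bound i eq)
      ... | false = z≤n

    ∧-adj-comm : ∀ a b i j → a ∧ b ∧ adj G i j ≡ b ∧ a ∧ adj G j i
    ∧-adj-comm a b i j = trans (x∙yz≈y∙xz a b (adj G i j)) (cong (λ c → b ∧ a ∧ c) (adj-sym G i j))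

    adjacentPairs-comm : ∀ X Y → adjacentPairs X Y ≡ adjacentPairs Y X
    adjacentPairs-comm X Y = trans (∑-comm (λ i j → [ X i ∧ Y j ∧ adj G i j ]))
      (sum-cong-≗ λ j → sum-cong-≗ λ i → cong [_] (∧-adj-comm (X i) (Y j) i j))

    adjacentPairs-split : ∀ X Y W → adjacentPairs X Y ≡ adjacentPairs (X ∩ W) Y + adjacentPairs (X ∖ W) Y
    adjacentPairs-split X Y W = trans (sum-cong-≗ row) (∑-distrib-+ (pairsFrom (X ∩ W)) (pairsFrom (X ∖ W)))
      where
      pairsFrom : (Fin (n G) → Bool) → Fin (n G) → ℕ
      pairsFrom X′ i = ∑[ j < n G ] [ X′ i ∧ Y j ∧ adj G i j ]
      row : ∀ i → pairsFrom X i ≡ pairsFrom (X ∩ W) i + pairsFrom (X ∖ W) i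
      row i = trans (sum-cong-≗ λ j → [∧]-split (X i) (W i) (Y j ∧ adj G i j))
        (∑-distrib-+ (λ j → [ (X ∩ W) i ∧ Y j ∧ adj G i j ]) (λ j → [ (X ∖ W) i ∧ Y j ∧ adj G i j ]))

    handshake : ∀ (T : Subset (n G)) S → (∀ i → lookup T i ≡ S i) → 2 * edgesIn G T ≡ adjacentPairs S S
    handshake T S T≗S = begin
      2 * edgesIn G T      ≡⟨ cong (2 *_) edgesIn≡below ⟩
      below + (below + 0)  ≡⟨ cong (below +_) (+-identityʳ below) ⟩
      below + below        ≡⟨ cong (below +_) above≡below ⟨
      below + above        ≡⟨ ∑-distrib-+ (λ i → ∑[ j < n G ] [ lt i j ∧ edge i j ])
                                          (λ i → ∑[ j < n G ] [ lt j i ∧ edge i j ]) ⟨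
      _                    ≡⟨ sum-cong-≗ (λ i → ∑-distrib-+ (λ j → [ lt i j ∧ edge i j ])
                                                           (λ j → [ lt j i ∧ edge i j ])) ⟨
      _                    ≡⟨ sum-cong-≗ (λ i → sum-cong-≗ (edge-split i)) ⟨
      adjacentPairs S S    ∎
      where
      open ≡-Reasoning
      edge lt : Fin (n G) → Fin (n G) → Bool
      edge i j = S i ∧ S j ∧ adj G i j
      lt i j = does (toℕ i <? toℕ j)
      below above : ℕ
      below = ∑[ i < n G ] ∑[ j < n G ] [ lt i j ∧ edge i j ]
      above = ∑[ i < n G ] ∑[ j < n G ] [ lt j i ∧ edge i j ]
      edgesIn≡below : edgesIn G T ≡ below
      edgesIn≡below = trans (sumFin²≡sum² λ i j → [ lt i j ∧ does (i ∈? T) ∧ does (j ∈? T) ∧ adj G i j ])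
        (sum-cong-≗ λ i → sum-cong-≗ λ j →
          cong₂ (λ a b → [ lt i j ∧ a ∧ b ∧ adj G i j ]) (membership i) (membership j))
        where
        membership : ∀ i → does (i ∈? T) ≡ S i
        membership i = trans (does-∈? i T) (T≗S i)
      above≡below : above ≡ below
      above≡below = trans (∑-comm (λ i j → [ lt j i ∧ edge i j ]))
        (sum-cong-≗ λ j → sum-cong-≗ λ i → cong (λ b → [ lt j i ∧ b ]) (∧-adj-comm (S i) (S j) i j))
      edge-irrefl : ∀ i → edge i i ≡ false
      edge-irrefl i rewrite irrefl G i | Bool.∧-zeroʳ (S i) = Bool.∧-zeroʳ (S i)
      edge-split : ∀ i j → [ edge i j ] ≡ [ lt i j ∧ edge i j ] + [ lt j i ∧ edge i j ]
      edge-split i j with <-cmp (toℕ i) (toℕ j)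
      ... | tri< i<j _ j≮i rewrite dec-true (toℕ i <? toℕ j) i<j | dec-false (toℕ j <? toℕ i) j≮i =
        sym (+-identityʳ _)
      ... | tri> i≮j _ j<i rewrite dec-false (toℕ i <? toℕ j) i≮j | dec-true (toℕ j <? toℕ i) j<i = refl
      ... | tri≈ _ i≡j _ with toℕ-injective i≡j
      ...   | refl rewrite edge-irrefl i | Bool.∧-zeroʳ (lt i i) = refl

    ∣∣≡size : ∀ (T : Subset (n G)) S → (∀ i → lookup T i ≡ S i) → ∣ T ∣ ≡ size S
    ∣∣≡size T S T≗S = trans (∣∣≡∑ T) (sum-cong-≗ λ i → cong [_] (T≗S i))

    handshake-V : 2 * edgesIn G ⊤ ≡ adjacentPairs V V
    handshake-V = handshake ⊤ V λ i → lookup-replicate i true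

    2e≤n² : 2 * edgesIn G ⊤ ≤ n G * n G
    2e≤n² = subst₂ _≤_ (sym handshake-V) (cong (_* n G) (∑1≡n (n G)))
      (adjacentPairs-≤ V V (n G) λ i _ → degreeIn≤n V i)

    averageHereditary⇒degreeSum-≤ : AverageHereditary G → .{{NonZero (n G)}} →
      ∀ S → 0 < size S → adjacentPairs S S * n G ≤ adjacentPairs V V * size S
    averageHereditary⇒degreeSum-≤ AH S 0<|S| = subst₂ _≤_
      (cong (_* n G) (handshake T S T≗S)) (cong₂ _*_ handshake-V (∣∣≡size T S T≗S))
      (avg-≤⇒ (edgesIn G T) ∣ T ∣ (edgesIn G ⊤) (n G) {{>-nonZero 0<∣T∣}} (AH T))
      where
      T : Subset (n G)
      T = tabulate S
      T≗S : ∀ i → lookup T i ≡ S i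
      T≗S = lookup∘tabulate S
      0<∣T∣ : 0 < ∣ T ∣
      0<∣T∣ = subst (0 <_) (sym (∣∣≡size T S T≗S)) 0<|S|

    -- Turán's theorem

    CliqueIn : (Fin (n G) → Bool) → ℕ → Set
    CliqueIn S k = Σ (Fin k → Fin (n G)) λ f →
      (∀ a → S (f a) ≡ true) × (∀ a b → a ≢ b → adj G (f a) (f b) ≡ true)

    clique-cons : ∀ {S v k} → S v ≡ true → CliqueIn (S ∩ adj G v) k → CliqueIn S (suc k)
    clique-cons {S} {v} S∋v (f , in-A , adjacent) = v Vector.∷ f , in-S , adjacent′
      where
      in-S : ∀ a → S ((v Vector.∷ f) a) ≡ true
      in-S zero    = S∋v
      in-S (suc a) = ∩-⊆ˡ S (adj G v) (f a) (in-A a)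
      v~f : ∀ a → adj G v (f a) ≡ true
      v~f a = ∩-⊆ʳ S (adj G v) (f a) (in-A a)
      adjacent′ : ∀ a b → a ≢ b → adj G ((v Vector.∷ f) a) ((v Vector.∷ f) b) ≡ true
      adjacent′ zero    zero    0≢0 = contradiction refl 0≢0
      adjacent′ zero    (suc b) _   = v~f b
      adjacent′ (suc a) zero    _   = trans (adj-sym G (f a) v) (v~f a)
      adjacent′ (suc a) (suc b) a≢b = adjacent a b (a≢b ∘ cong suc)

    adjacentPairs-≤-neighbourhood : ∀ S v Δ → (∀ i → S i ≡ true → degreeIn S i ≤ Δ) →
      adjacentPairs S S ≤
        adjacentPairs (S ∩ adj G v) (S ∩ adj G v) + size (S ∖ adj G v) * Δ + size (S ∖ adj G v) * Δ
    adjacentPairs-≤-neighbourhood S v Δ Δ-max = begin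
      adjacentPairs S S                          ≡⟨ adjacentPairs-split S S (adj G v) ⟩
      adjacentPairs A S + adjacentPairs B S      ≡⟨ cong (_+ adjacentPairs B S) (adjacentPairs-comm A S) ⟩
      adjacentPairs S A + adjacentPairs B S
        ≡⟨ cong (_+ adjacentPairs B S) (adjacentPairs-split S A (adj G v)) ⟩
      adjacentPairs A A + adjacentPairs B A + adjacentPairs B S
        ≤⟨ +-mono-≤ (+-monoʳ-≤ (adjacentPairs A A) (adjacentPairs-≤ B A Δ degreeIn-A≤Δ))
                    (adjacentPairs-≤ B S Δ degreeIn-S≤Δ) ⟩
      adjacentPairs A A + size B * Δ + size B * Δ  ∎
      where
      open ≤-Reasoning
      A B : Fin (n G) → Bool
      A = S ∩ adj G v
      B = S ∖ adj G v
      degreeIn-S≤Δ : ∀ i → B i ≡ true → degreeIn S i ≤ Δ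
      degreeIn-S≤Δ i B∋i = Δ-max i (∖-⊆ S (adj G v) i B∋i)
      degreeIn-A≤Δ : ∀ i → B i ≡ true → degreeIn A i ≤ Δ
      degreeIn-A≤Δ i B∋i = ≤-trans (degreeIn-mono (∩-⊆ˡ S (adj G v)) i) (degreeIn-S≤Δ i B∋i)

    turán : ∀ r S → CliqueIn S (suc r) ⊎ r * adjacentPairs S S + size S * size S ≤ r * (size S * size S)
    turán r S with 0 <? size S
    turán r S | no |S|≯0 = inj₂ (subst (λ s → r * adjacentPairs S S + s * s ≤ r * (s * s)) (sym |S|≡0)
      (≤-reflexive (trans (+-identityʳ _) (cong (r *_) pairs≡0))))
      where
      |S|≡0 : size S ≡ 0
      |S|≡0 = n≤0⇒n≡0 (≮⇒≥ |S|≯0)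
      pairs≡0 : adjacentPairs S S ≡ 0
      pairs≡0 = n≤0⇒n≡0 (subst (λ s → adjacentPairs S S ≤ s * n G) |S|≡0
        (adjacentPairs-≤ S S (n G) (λ i _ → degreeIn≤n S i)))
    turán zero S | yes 0<|S| with nonempty S 0<|S|
    ... | i , S∋i = inj₁ ((λ _ → i) , (λ _ → S∋i) , λ { zero zero 0≢0 → contradiction refl 0≢0 })
    turán (suc p) S | yes 0<|S| with argmaxOn S (degreeIn S) (nonempty S 0<|S|)
    ... | v , S∋v , Δ-max with turán p (S ∩ adj G v)
    ...   | inj₁ clique = inj₁ (clique-cons S∋v clique)
    ...   | inj₂ IH = inj₂ (subst (λ s → suc p * adjacentPairs S S + s * s ≤ suc p * (s * s)) (sym |S|≡Δ+b)
            (turán-step p _ _ Δ (size B) IH (adjacentPairs-≤-neighbourhood S v Δ Δ-max)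
              (subst (λ s → adjacentPairs S S ≤ s * Δ) |S|≡Δ+b (adjacentPairs-≤ S S Δ Δ-max))))
      where
      Δ : ℕ
      Δ = degreeIn S v
      B : Fin (n G) → Bool
      B = S ∖ adj G v
      |S|≡Δ+b : size S ≡ Δ + size B
      |S|≡Δ+b = size-split S (adj G v)

    cliqueIn⇒hasClique : ∀ {k} → CliqueIn V k → HasClique G k
    cliqueIn⇒hasClique (f , _ , adjacent) = f , injective , adjacent
      where
      injective : ∀ {a b} → f a ≡ f b → a ≡ b
      injective {a} {b} fa≡fb with a ≟ b
      ... | yes a≡b = a≡b
      ... | no  a≢b = contradiction
        (trans (sym (adjacent a b a≢b)) (subst (λ x → adj G (f a) x ≡ false) fa≡fb (irrefl G (f a)))) λ ()

    dense⇒clique : ∀ q → q * (n G * n G) < n G * n G + q * (2 * edgesIn G ⊤) → HasClique G (suc q)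
    dense⇒clique q dense with turán q V
    ... | inj₁ clique = cliqueIn⇒hasClique clique
    ... | inj₂ sparse = contradiction
      (<-≤-trans dense′ (≤-trans (≤-reflexive (+-comm (n G * n G) (q * adjacentPairs V V))) sparse′))
      (<-irrefl refl)
      where
      dense′ : q * (n G * n G) < n G * n G + q * adjacentPairs V V
      dense′ = subst (λ d → q * (n G * n G) < n G * n G + q * d) handshake-V dense
      sparse′ : q * adjacentPairs V V + n G * n G ≤ q * (n G * n G)
      sparse′ = subst (λ s → q * adjacentPairs V V + s * s ≤ q * (s * s)) (∑1≡n (n G)) sparse

    -- Greedy colouring of degenerate graphs

    ColourableOn : (Fin (n G) → Bool) → ℕ → Set
    ColourableOn S k = Σ (Fin (n G) → Fin k) λ c →
      ∀ i j → S i ≡ true → S j ≡ true → adj G i j ≡ true → c i ≢ c j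

    missing-colour : ∀ {k} (c : Fin (n G) → Fin k) X → size X < k →
      ∃ λ col → ∀ j → X j ≡ true → c j ≢ col
    missing-colour {k} c X |X|<k
      with sum-<⇒∃< uses (λ _ → 1) (subst₂ _<_ (sym Σuses≡|X|) (sym (∑1≡n k)) |X|<k)
      where
      uses : Fin k → ℕ
      uses col = ∑[ j < n G ] [ X j ∧ does (col ≟ c j) ]
      Σuses≡|X| : ∑[ col < k ] uses col ≡ size X
      Σuses≡|X| = trans (∑-comm λ col j → [ X j ∧ does (col ≟ c j) ]) (sum-cong-≗ colours-of)
        where
        colours-of : ∀ j → ∑[ col < k ] [ X j ∧ does (col ≟ c j) ] ≡ [ X j ]
        colours-of j with X j
        ... | true  = ∑[≟]≡1 (c j)
        ... | false = ∑0≡0 k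
    ... | col , uses<1 = col , λ j X∋j cj≡col →
      <⇒≱ uses<1 (≤-trans (≤-reflexive (sym (counted j X∋j cj≡col))) (≤-sum _ j))
      where
      counted : ∀ j → X j ≡ true → c j ≡ col → [ X j ∧ does (col ≟ c j) ] ≡ 1
      counted j X∋j refl rewrite X∋j | dec-true (c j ≟ c j) refl = refl

    size-remove : ∀ S v → S v ≡ true → size S ≡ suc (size (S ∖ ⁅ v ⁆))
    size-remove S v S∋v = trans (size-split S ⁅ v ⁆) (cong (_+ size (S ∖ ⁅ v ⁆)) (size-singleton S v S∋v))

    colour-extend : ∀ {q} S v → S v ≡ true → degreeIn S v ≤ q →
      ColourableOn (S ∖ ⁅ v ⁆) (suc q) → ColourableOn S (suc q)
    colour-extend {q} S v S∋v deg≤q (c , proper) = recolour , proper′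
      where
      R : Fin (n G) → Bool
      R = S ∖ ⁅ v ⁆
      free : ∃ λ col → ∀ j → (R ∩ adj G v) j ≡ true → c j ≢ col
      free = missing-colour c (R ∩ adj G v) (s≤s (≤-trans (degreeIn-mono (∖-⊆ S ⁅ v ⁆) v) deg≤q))
      col : Fin (suc q)
      col = proj₁ free
      recolour : Fin (n G) → Fin (suc q)
      recolour i = if does (i ≟ v) then col else c i
      R∋ : ∀ j → S j ≡ true → j ≢ v → R j ≡ true
      R∋ j S∋j j≢v rewrite S∋j | dec-false (j ≟ v) j≢v = refl
      free′ : ∀ j → S j ≡ true → j ≢ v → adj G v j ≡ true → c j ≢ col
      free′ j S∋j j≢v v~j =
        proj₂ free j (subst₂ (λ a b → a ∧ b ≡ true) (sym (R∋ j S∋j j≢v)) (sym v~j) refl)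
      proper′ : ∀ i j → S i ≡ true → S j ≡ true → adj G i j ≡ true → recolour i ≢ recolour j
      proper′ i j S∋i S∋j i~j with i ≟ v | j ≟ v
      ... | yes refl | yes refl = contradiction (trans (sym i~j) (irrefl G i)) λ ()
      ... | yes refl | no j≢v = λ col≡cj → free′ j S∋j j≢v i~j (sym col≡cj)
      ... | no i≢v | yes refl = free′ i S∋i i≢v (trans (adj-sym G j i) i~j)
      ... | no i≢v | no j≢v = proper i j (R∋ i S∋i i≢v) (R∋ j S∋j j≢v) i~j

    Degenerate : ℕ → Set
    Degenerate q = ∀ S → 0 < size S → ∃ λ v → S v ≡ true × degreeIn S v ≤ q

    degenerate⇒colourableOn : ∀ {q} → Degenerate q → ∀ k S → size S ≡ k → ColourableOn S (suc q)
    degenerate⇒colourableOn _ zero S |S|≡0 =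
      (λ _ → zero) , λ i _ S∋i _ _ _ → <-irrefl (sym |S|≡0) (∈⇒0<size S i S∋i)
    degenerate⇒colourableOn low (suc k) S |S|≡1+k with low S (subst (0 <_) (sym |S|≡1+k) z<s)
    ... | v , S∋v , deg≤q = colour-extend S v S∋v deg≤q
      (degenerate⇒colourableOn low k (S ∖ ⁅ v ⁆) (suc-injective (trans (sym (size-remove S v S∋v)) |S|≡1+k)))

    degenerate⇒colourable : ∀ {q} → Degenerate q → Colourable G (suc q)
    degenerate⇒colourable low with degenerate⇒colourableOn low (size V) V refl
    ... | c , proper = c , λ i j → proper i j refl refl

    averageHereditary⇒degenerate : AverageHereditary G → .{{NonZero (n G)}} →
      ∀ q → 2 * edgesIn G ⊤ < suc q * n G → Degenerate q
    averageHereditary⇒degenerate AH q 2e<[1+q]n S 0<|S|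
      with any? (λ v → (S v Bool.≟ true) ×-dec (degreeIn S v ≤? q))
    ... | yes low-vertex = low-vertex
    ... | no  none = contradiction (begin-strict
      size S * suc q * n G       ≤⟨ *-monoˡ-≤ (n G) (size*δ≤adjacentPairs S S (suc q) high-degree) ⟩
      adjacentPairs S S * n G    ≤⟨ averageHereditary⇒degreeSum-≤ AH S 0<|S| ⟩
      adjacentPairs V V * size S
        <⟨ *-monoˡ-< (size S) {{>-nonZero 0<|S|}} (subst (_< suc q * n G) handshake-V 2e<[1+q]n) ⟩
      suc q * n G * size S       ≡⟨ rotate (suc q) (n G) (size S) ⟩
      size S * suc q * n G       ∎) (<-irrefl refl)
      where
      open ≤-Reasoning
      high-degree : ∀ v → S v ≡ true → suc q ≤ degreeIn S v
      high-degree v S∋v = ≰⇒> λ deg≤q → none (v , S∋v , deg≤q)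
      rotate : ∀ a b c → a * b * c ≡ c * a * b
      rotate = solve-∀

    clique≤colours : ∀ {k m} → HasClique G k → Colourable G m → k ≤ m
    clique≤colours (f , _ , adjacent) (c , proper) = injective⇒≤ injective
      where
      injective : ∀ {a b} → c (f a) ≡ c (f b) → a ≡ b
      injective {a} {b} same-colour with a ≟ b
      ... | yes a≡b = a≡b
      ... | no  a≢b = contradiction same-colour (proper (f a) (f b) (adjacent a b a≢b))

    colourable∧clique⇒χ≡ω : ∀ {k} → Colourable G k → HasClique G k →
      IsChromaticNumber G k × IsCliqueNumber G k
    colourable∧clique⇒χ≡ω colourable clique =
      (colourable , λ m → clique≤colours clique) , (clique , λ m clique′ → clique≤colours clique′ colourable)

open import Defs
open import Data.Nat using (ℕ; NonZero)
open import Data.Integer using (+_)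
open import Data.Rational using (ℚ; floor; ceiling; _+_; _-_; _÷_; 1ℚ)
open import Data.Product using (Σ; _×_)
open import Relation.Binary.PropositionalEquality using (_≡_)
open import Data.Nat using (suc)
open import Data.Fin.Subset using (⊤)
open import Data.Product using (_,_)
open import Relation.Binary.PropositionalEquality using (trans)
open RationalBounds using (floor-avg+1; ceiling-ratio)
open Combinatorics

corollary2 : (G : Graph) → AverageHereditary G → NonZero (n G)
  → {{nz : Data.Rational.NonZero (ℕ→ℚ (n G) - avgDeg G)}}
  → ceiling (ℕ→ℚ (n G) ÷ (ℕ→ℚ (n G) - avgDeg G))
    ≡ floor (avgDeg G + 1ℚ)
  → Σ ℕ λ k → floor (avgDeg G + 1ℚ) ≡ + k × IsChromaticNumber G k × IsCliqueNumber G k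
corollary2 G AH n≢0 ceiling≡floor with floor-avg+1 (edgesIn G ⊤) (n G) {{n≢0}}
... | q , floor≡1+q , 2e<[1+q]n = suc q , floor≡1+q , colourable∧clique⇒χ≡ω G colourable clique
  where
  instance
    n-nonZero : NonZero (n G)
    n-nonZero = n≢0
  colourable : Colourable G (suc q)
  colourable = degenerate⇒colourable G (averageHereditary⇒degenerate G AH q 2e<[1+q]n)
  clique : HasClique G (suc q)
  clique = dense⇒clique G q (ceiling-ratio (edgesIn G ⊤) (n G) q (2e≤n² G) (trans ceiling≡floor floor≡1+q))
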